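{- Under the path orders $(\preceq_-,\preceq_+)=(\le_{\mathrm{pos}},\le_{\mathrm{lex}})$, for every rank $i\in[n]$, if $i\notin QI_{BWT}$ then $BWT[i]=BWT[i-1]\in\Sigma$.
   Context: Let $T=T[1..n]$ be a text over an integer alphabet with total order, ending with a unique smallest end-marker $\$$. For a suffix $S$, $\mathrm{rnk}(S)$ is its rank among all suffixes in lexicographic order $\le_{\mathrm{lex}}$. $SA$ is the suffix array and $BWT[k]=T[n]$ if $SA[k]=1$, else $T[SA[k]-1]$. The CDAWG $G$ of $T$ is the edge-labeled DAG obtained from the suffix tree of $T$ by merging isomorphic subtrees; it has a root and a sink, edges with nonempty labels, outgoing edges of a node start with distinct symbols, and spelling root-to-sink paths is a bijection onto the suffixes of $T$; $E$ is its edge set. For a node $v$, $N_-(v)$/$N_+(v)$ are incoming/outgoing edges, $U_-(v)$ the strings spelled by root-to-$v$ paths, $U_+(v)$ those spelled by $v$-to-sink paths. $\mathrm{repr}_-(v)$ is the longest string of $U_-(v)$ and $\mathrm{repr}_+(v)$ the lexicographically smallest string of $U_+(v)$ (strings identified with their unique paths). An edge of $N_-(v)$ is $(-)$-primary if it is the last edge of the path of $\mathrm{repr}_-(v)$; an edge of $N_+(v)$ is $(+)$-primary if it is the first edge of the path of $\mathrm{repr}_+(v)$; $EP_\delta$ = $\delta$-primary edges, $ES_\delta=E\setminus EP_\delta$. A suffix with root-to-sink path $(f_1,\dots,f_\ell)$ is $(-)$-canonical if either all $f_i\in EP_-$, or for some $k$: $f_1,\dots,f_{k-1}\in EP_-$,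 $f_k\in ES_-$, $f_{k+1},\dots,f_\ell\in EP_+$. $CS_-$ is the set of $(-)$-canonical suffixes and $QI_{BWT}=\{\mathrm{rnk}(S):S\in CS_-\}$. -}

module Defs where

open import Data.Nat using (ℕ; zero; suc; _+_; _<_; _≤_; _<ᵇ_; _≡ᵇ_)
open import Data.Bool using (Bool; true; false; if_then_else_)
open import Data.List using (List; []; _∷_; _++_; [_]; length; drop; take; map; upTo)
open import Data.Nat.ListAction using (sum)
open import Data.List.Relation.Unary.All using (All)
open import Data.Product using (Σ; Σ-syntax; _×_)
open import Data.Sum using (_⊎_)
open import Relation.Nullary using (¬_)
open import Relation.Binary.PropositionalEquality using (_≡_; _≢_)

Str : Set
Str = List ℕ

-- T is a text: it ends with a unique smallest end-marker $ (= d).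
IsText : Str → Set
IsText T = Σ[ w ∈ Str ] Σ[ d ∈ ℕ ] (T ≡ w ++ [ d ]) × All (d <_) w

leqLex : Str → Str → Bool
leqLex [] _ = true
leqLex (x ∷ xs) [] = false
leqLex (x ∷ xs) (y ∷ ys) = if x <ᵇ y then true else (if x ≡ᵇ y then leqLex xs ys else false)

_≤lex_ : Str → Str → Set
s ≤lex t = leqLex s t ≡ true

module Text (T : Str) where

  n : ℕ
  n = length T

  -- the suffix T[k+1..n] (0-based starting position k, k < n)
  suf : ℕ → Str
  suf k = drop k T

  Suf : Str → Set
  Suf s = Σ[ k ∈ ℕ ] (k < n) × (suf k ≡ s)

  Occ : Str → Set
  Occ y = Σ[ k ∈ ℕ ] Σ[ z ∈ Str ] drop k T ≡ y ++ z

  -- rnk(suf k) = number of suffixes ≤lex suf k  (ranks are 1..n)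
  rnk : ℕ → ℕ
  rnk k = sum (map (λ k' → if leqLex (suf k') (suf k) then 1 else 0) (upTo n))

  -- the character preceding the suffix starting at k (cyclically: T[n] for the whole text)
  prevChar : ℕ → Str
  prevChar zero = drop (n Data.Nat.∸ 1) T
  prevChar (suc k) = take 1 (drop k T)

  -- BWT[i] = c  (i a rank, SA[i] = k+1)
  BWT : ℕ → ℕ → Set
  BWT i c = Σ[ k ∈ ℕ ] (k < n) × (rnk k ≡ i) × (prevChar k ≡ [ c ])

  -- right-branching substring (internal non-root node of the suffix tree)
  Branching : Str → Set
  Branching x = Σ[ a ∈ ℕ ] Σ[ b ∈ ℕ ] (a ≢ b) × Occ (x ++ [ a ]) × Occ (x ++ [ b ])

  -- explicit (branching) nodes of the suffix tree, from which edges leave: root or branching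
  Node : Str → Set
  Node x = (x ≡ []) ⊎ Branching x

  -- target nodes of edges: branching nodes or leaves (= suffixes)
  Target : Str → Set
  Target x = Branching x ⊎ Suf x

  -- CDAWG nodes = suffix-tree nodes modulo ∼; for a node v (class of x),
  -- U_-(v) = the ∼-class, U_+(v) = {z | xz is a suffix}.
  _∼_ : Str → Str → Set
  x ∼ y = ∀ z → (Suf (x ++ z) → Suf (y ++ z)) × (Suf (y ++ z) → Suf (x ++ z))

  -- CDAWG edges: pairs (x , c) with Node x and x c occurring, where (x , c) and (y , c)
  -- denote the same CDAWG edge iff x ∼ y (outgoing edges start with distinct symbols).

  -- L = repr_-(v) for the node v containing L: the longest string of its class
  LongestInClass : Str → Set
  LongestInClass L = ∀ y → y ∼ L → length y ≤ length L

  -- the last edge of the path of L starts at the suffix-tree node p with first symbol c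
  LastEdge : Str → Str → ℕ → Set
  LastEdge L p c =
    Node p × (Σ[ β ∈ Str ] L ≡ p ++ c ∷ β) ×
    (∀ q d γ → L ≡ q ++ d ∷ γ → Node q → length q ≤ length p)

  -- (-)-primary edges: last edge of the path of repr_-(target)
  EPm : Str → ℕ → Set
  EPm x c = Σ[ L ∈ Str ] Σ[ p ∈ Str ]
    Target L × LongestInClass L × LastEdge L p c × (p ∼ x)

  -- (+)-primary edges: first edge of the path of repr_+(source) = lex-smallest z with xz a suffix
  EPp : Str → ℕ → Set
  EPp x c = Σ[ z ∈ Str ] Suf (x ++ c ∷ z) × (∀ z' → Suf (x ++ z') → (c ∷ z) ≤lex z')

  -- the j-th symbol position of S starts an edge of the root-to-sink path of S,
  -- namely the edge (x , c) leaving the node x = S[1..j]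
  EdgeAt : Str → ℕ → Str → ℕ → Set
  EdgeAt S j x c = Node x × (take j S ≡ x) × (Σ[ r ∈ Str ] drop j S ≡ c ∷ r)

  Canonical : Str → Set
  Canonical S =
    (∀ j x c → EdgeAt S j x c → EPm x c)
    ⊎ (Σ[ k ∈ ℕ ] Σ[ xk ∈ Str ] Σ[ ck ∈ ℕ ]
         EdgeAt S k xk ck × ¬ EPm xk ck
         × (∀ j x c → j < k → EdgeAt S j x c → EPm x c)
         × (∀ j x c → k < j → EdgeAt S j x c → EPp x c))

  InQI : ℕ → Set
  InQI i = Σ[ k ∈ ℕ ] (k < n) × Canonical (suf k) × (rnk k ≡ i)

{-# OPTIONS --safe #-}
module Submission where

-- Let S be the suffix of rank i and S′ the one of rank i − 1, and suppose their
-- preceding symbols differ.  Because of the end-marker S′ is not a prefix of S, so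
-- S′ = x c′ r′ and S = x c r with c′ < c.  Every edge on the path of x is
-- (−)-primary: the first node y below it is entered by both suffixes, whose
-- preceding symbols differ, so no longer string has the right context of y; thus
-- y = repr₋ of its node.  Every edge after the one leaving x is (+)-primary, since S
-- is the lex-smallest suffix starting with x c: a smaller one would have a rank
-- strictly between i − 1 and i.  So S is (−)-canonical and i ∈ QI_BWT.  For i = 1
-- the same argument runs with x empty.

open import Defs
open import Data.Bool using (Bool; true; false; if_then_else_)
open import Data.Bool.Properties using (¬-not)
import Data.Bool.Properties as Bool
open import Data.Empty using (⊥-elim)
open import Data.Fin using (Fin; toℕ; fromℕ<; punchOut)
open import Data.Fin.Properties using (any?; punchOut-injective; injective⇒≤; toℕ<n; toℕ-fromℕ<; toℕ-injective)
import Data.Fin.Properties as Fin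
open import Data.List using (List; []; _∷_; _++_; [_]; length; drop; take; map; upTo)
open import Data.List.Properties using (++-assoc; ++-identityʳ; take-all; length-take; length-drop; length-++; length-upTo; drop-drop; take++drop≡id; ∷-injectiveˡ; ∷-injectiveʳ; ≡-dec)
open import Data.List.Membership.Propositional using (_∈_)
open import Data.List.Membership.Propositional.Properties using (∈-upTo⁺)
open import Data.List.Relation.Unary.All using (All; _∷_)
open import Data.List.Relation.Unary.All.Properties using (drop⁺)
open import Data.List.Relation.Unary.Any using (here; there)
open import Data.Nat using (ℕ; zero; suc; pred; _+_; _∸_; _≤_; _<_; _<ᵇ_; _≡ᵇ_; z≤n; s≤s; s≤s⁻¹; >-nonZero)
open import Data.Nat.ListAction using (sum)
open import Data.Nat.Properties
open import Data.Nat.Solver using (module +-*-Solver)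
open import Data.Product using (Σ-syntax; ∃-syntax; _×_; _,_; proj₁; proj₂)
open import Data.Sum using (_⊎_; inj₁; inj₂; [_,_]′)
open import Function using (_∘_; id)
open import Function.Definitions using (Injective)
open import Relation.Binary using (tri<; tri≈; tri>)
open import Relation.Binary.PropositionalEquality hiding ([_])
open import Relation.Nullary using (¬_; Dec; yes; no; ¬?; _×-dec_)
open import Relation.Nullary.Decidable using (¬¬-excluded-middle)

LeastBelow : (ℕ → Set) → ℕ → Set
LeastBelow P M = Σ[ m ∈ ℕ ] m < M × P m × (∀ m' → m' < m → ¬ P m')

least-or-none : ∀ (P : ℕ → Set) M → (∀ m → m < M → Dec (P m)) →
  LeastBelow P M ⊎ (∀ m → m < M → ¬ P m)
least-or-none P zero P? = inj₂ (λ _ ())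
least-or-none P (suc M) P? with least-or-none P M (λ m m<M → P? m (m<n⇒m<1+n m<M))
... | inj₁ (m , m<M , Pm , least) = inj₁ (m , m<n⇒m<1+n m<M , Pm , least)
... | inj₂ none with P? M (n<1+n M)
...   | yes PM = inj₁ (M , n<1+n M , PM , none)
...   | no ¬PM = inj₂ λ m m<1+M →
  [ none m , (λ { refl → ¬PM }) ]′ (m≤n⇒m<n∨m≡n (s≤s⁻¹ m<1+M))

¬¬-decidable-below : ∀ (P : ℕ → Set) M → ¬ ¬ (∀ m → m < M → Dec (P m))
¬¬-decidable-below P zero k = k (λ _ ())
¬¬-decidable-below P (suc M) k = ¬¬-decidable-below P M λ P? → ¬¬-excluded-middle λ PM? →
  k (λ m m<1+M → [ P? m , (λ { refl → PM? }) ]′ (m≤n⇒m<n∨m≡n (s≤s⁻¹ m<1+M)))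

leqLex-head< : ∀ {x y} xs ys → x < y → (x ∷ xs) ≤lex (y ∷ ys)
leqLex-head< {x} {y} xs ys x<y with x <ᵇ y | <⇒<ᵇ x<y
... | true | _ = refl

leqLex-head≡ : ∀ x xs ys → leqLex (x ∷ xs) (x ∷ ys) ≡ leqLex xs ys
leqLex-head≡ x xs ys with x <ᵇ x | <ᵇ⇒< x x
... | true | x<x = ⊥-elim (<-irrefl refl (x<x _))
... | false | _ with x ≡ᵇ x | ≡⇒≡ᵇ x x refl
...   | true | _ = refl

leqLex-head> : ∀ {x y} xs ys → y < x → ¬ (x ∷ xs) ≤lex (y ∷ ys)
leqLex-head> {x} {y} xs ys y<x with x <ᵇ y | <ᵇ⇒< x y
... | true | x<y = λ _ → <-asym y<x (x<y _)
... | false | _ with x ≡ᵇ y | ≡ᵇ⇒≡ x y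
...   | true | x≡y = λ _ → <-irrefl (sym (x≡y _)) y<x
...   | false | _ = λ ()

_≤lex?_ : ∀ s t → Dec (s ≤lex t)
s ≤lex? t = leqLex s t Bool.≟ true

≤lex-refl : ∀ s → s ≤lex s
≤lex-refl [] = refl
≤lex-refl (x ∷ s) = trans (leqLex-head≡ x s s) (≤lex-refl s)

≤lex-total : ∀ s t → ¬ s ≤lex t → t ≤lex s
≤lex-total [] t s≰t = ⊥-elim (s≰t refl)
≤lex-total (x ∷ s) [] _ = refl
≤lex-total (x ∷ s) (y ∷ t) s≰t with <-cmp x y
... | tri< x<y _ _ = ⊥-elim (s≰t (leqLex-head< s t x<y))
... | tri≈ _ refl _ = trans (leqLex-head≡ x t s) (≤lex-total s t (s≰t ∘ trans (leqLex-head≡ x s t)))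
... | tri> _ _ y<x = leqLex-head< t s y<x

≤lex-antisym : ∀ s t → s ≤lex t → t ≤lex s → s ≡ t
≤lex-antisym [] [] _ _ = refl
≤lex-antisym (x ∷ s) (y ∷ t) s≤t t≤s with <-cmp x y
... | tri< x<y _ _ = ⊥-elim (leqLex-head> t s x<y t≤s)
... | tri≈ _ refl _ = cong (x ∷_) (≤lex-antisym s t (trans (sym (leqLex-head≡ x s t)) s≤t)
                                                   (trans (sym (leqLex-head≡ x t s)) t≤s))
... | tri> _ _ y<x = ⊥-elim (leqLex-head> s t y<x s≤t)

≤lex-trans : ∀ s t u → s ≤lex t → t ≤lex u → s ≤lex u
≤lex-trans [] t u _ _ = refl
≤lex-trans (x ∷ s) (y ∷ t) (z ∷ u) s≤t t≤u with <-cmp x y | <-cmp y z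
... | tri> _ _ y<x | _ = ⊥-elim (leqLex-head> s t y<x s≤t)
... | _ | tri> _ _ z<y = ⊥-elim (leqLex-head> t u z<y t≤u)
... | tri< x<y _ _ | tri< y<z _ _ = leqLex-head< s u (<-trans x<y y<z)
... | tri< x<y _ _ | tri≈ _ refl _ = leqLex-head< s u x<y
... | tri≈ _ refl _ | tri< y<z _ _ = leqLex-head< s u y<z
... | tri≈ _ refl _ | tri≈ _ refl _ = trans (leqLex-head≡ x s u)
  (≤lex-trans s t u (trans (sym (leqLex-head≡ x s t)) s≤t) (trans (sym (leqLex-head≡ x t u)) t≤u))

leqLex-++ : ∀ p s t → leqLex (p ++ s) (p ++ t) ≡ leqLex s t
leqLex-++ [] s t = refl
leqLex-++ (x ∷ p) s t = trans (leqLex-head≡ x (p ++ s) (p ++ t)) (leqLex-++ p s t)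

record Divergence (s t : Str) : Set where
  constructor divergence
  field
    common : Str
    {a b} : ℕ
    {s′ t′} : Str
    a<b : a < b
    s≡ : s ≡ common ++ a ∷ s′
    t≡ : t ≡ common ++ b ∷ t′

≤lex-split : ∀ s t → s ≤lex t → (∃[ u ] s ++ u ≡ t) ⊎ Divergence s t
≤lex-split [] t _ = inj₁ (t , refl)
≤lex-split (x ∷ s) (y ∷ t) s≤t with <-cmp x y
... | tri< x<y _ _ = inj₂ (divergence [] x<y refl refl)
... | tri> _ _ y<x = ⊥-elim (leqLex-head> s t y<x s≤t)
... | tri≈ _ refl _ with ≤lex-split s t (trans (sym (leqLex-head≡ x s t)) s≤t)
...   | inj₁ (u , s++u≡t) = inj₁ (u , cong (x ∷_) s++u≡t)
...   | inj₂ (divergence p a<b refl refl) = inj₂ (divergence (x ∷ p) a<b refl refl)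

-- Text.rnk k unfolds to count (λ k′ → leqLex (suf k′) (suf k)) (upTo n).
count : {A : Set} → (A → Bool) → List A → ℕ
count f xs = sum (map (λ x → if f x then 1 else 0) xs)

module _ {A : Set} (f g : A → Bool) (f⇒g : ∀ x → f x ≡ true → g x ≡ true) where

  indicator-mono : ∀ x → (if f x then 1 else 0) ≤ (if g x then 1 else 0)
  indicator-mono x with f x | f⇒g x
  ... | false | _ = z≤n
  ... | true | g-true rewrite g-true refl = ≤-refl

  count-mono : ∀ xs → count f xs ≤ count g xs
  count-mono [] = z≤n
  count-mono (x ∷ xs) = +-mono-≤ (indicator-mono x) (count-mono xs)

  count-mono-< : ∀ {y} xs → y ∈ xs → f y ≡ false → g y ≡ true → count f xs < count g xs
  count-mono-< (x ∷ xs) (here refl) fy gy rewrite fy | gy = s≤s (count-mono xs)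
  count-mono-< (x ∷ xs) (there y∈xs) fy gy = +-mono-≤-< (indicator-mono x) (count-mono-< xs y∈xs fy gy)

count-≤-length : ∀ {A : Set} (f : A → Bool) xs → count f xs ≤ length xs
count-≤-length f [] = z≤n
count-≤-length f (x ∷ xs) with f x
... | true = s≤s (count-≤-length f xs)
... | false = m≤n⇒m≤1+n (count-≤-length f xs)

count-pos : ∀ {A : Set} (f : A → Bool) {y} xs → y ∈ xs → f y ≡ true → 0 < count f xs
count-pos f (x ∷ xs) (here refl) fy rewrite fy = s≤s z≤n
count-pos f (x ∷ xs) (there y∈xs) fy = <-≤-trans (count-pos f xs y∈xs fy) (m≤n+m _ _)

Fin-injective⇒surjective : ∀ {N} {f : Fin N → Fin N} → Injective _≡_ _≡_ f → ∀ i → ∃[ a ] f a ≡ i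
Fin-injective⇒surjective {suc N} {f} f-inj i with any? (λ a → f a Fin.≟ i)
... | yes hit = hit
... | no miss = ⊥-elim (<-irrefl refl (injective⇒≤ g-inj))
  where
  i≢f : ∀ a → i ≢ f a
  i≢f a i≡fa = miss (a , sym i≡fa)
  g : Fin (suc N) → Fin N
  g a = punchOut (i≢f a)
  g-inj : Injective _≡_ _≡_ g
  g-inj = f-inj ∘ punchOut-injective (i≢f _) (i≢f _)

injective-below⇒surjective : ∀ N (f : ℕ → ℕ) → (∀ k → k < N → f k < N) →
  (∀ {k₁ k₂} → k₁ < N → k₂ < N → f k₁ ≡ f k₂ → k₁ ≡ k₂) →
  ∀ {i} → i < N → ∃[ k ] k < N × f k ≡ i
injective-below⇒surjective N f f<N f-inj i<N with Fin-injective⇒surjective F-inj (fromℕ< i<N)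
  where
  F : Fin N → Fin N
  F a = fromℕ< (f<N (toℕ a) (toℕ<n a))
  toℕ-F : ∀ a → toℕ (F a) ≡ f (toℕ a)
  toℕ-F a = toℕ-fromℕ< (f<N (toℕ a) (toℕ<n a))
  F-inj : Injective _≡_ _≡_ F
  F-inj {a} {b} Fa≡Fb = toℕ-injective (f-inj (toℕ<n a) (toℕ<n b)
    (trans (sym (toℕ-F a)) (trans (cong toℕ Fa≡Fb) (toℕ-F b))))
... | a , Fa≡i = toℕ a , toℕ<n a , trans (sym (toℕ-fromℕ< _)) (trans (cong toℕ Fa≡i) (toℕ-fromℕ< i<N))

take-++ˡ : ∀ m (x u : Str) → m ≤ length x → take m (x ++ u) ≡ take m x
take-++ˡ zero x u _ = refl
take-++ˡ (suc m) (a ∷ x) u (s≤s m≤x) = cong (a ∷_) (take-++ˡ m x u m≤x)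

drop-++ˡ : ∀ m (x u : Str) → m ≤ length x → drop m (x ++ u) ≡ drop m x ++ u
drop-++ˡ zero x u _ = refl
drop-++ˡ (suc m) (a ∷ x) u (s≤s m≤x) = drop-++ˡ m x u m≤x

take-length-++ : ∀ (x u : Str) → take (length x) (x ++ u) ≡ x
take-length-++ [] u = refl
take-length-++ (a ∷ x) u = cong (a ∷_) (take-length-++ x u)

length-take-≤ : ∀ m (x : Str) → m ≤ length x → length (take m x) ≡ m
length-take-≤ m x m≤x = trans (length-take m x) (m≤n⇒m⊓n≡m m≤x)

drop≡∷⇒< : ∀ j (x : Str) {c r} → drop j x ≡ c ∷ r → j < length x
drop≡∷⇒< zero (a ∷ x) _ = s≤s z≤n
drop≡∷⇒< (suc j) (a ∷ x) e = s≤s (drop≡∷⇒< j x e)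

-- 0 is a junk value; head₀ is only applied to nonempty lists.
head₀ : Str → ℕ
head₀ [] = 0
head₀ (c ∷ _) = c

drop-head₀ : ∀ j (x : Str) → j < length x → drop j x ≡ head₀ (drop j x) ∷ drop (suc j) x
drop-head₀ zero (a ∷ x) _ = refl
drop-head₀ (suc j) (a ∷ x) (s≤s j<x) = drop-head₀ j x j<x

prefix-< : ∀ (x y : Str) {c v t} → x ++ c ∷ v ≡ y ++ t → length x < length y → ∃[ β ] y ≡ x ++ c ∷ β
prefix-< [] (b ∷ y) e _ = y , cong (_∷ y) (sym (∷-injectiveˡ e))
prefix-< (a ∷ x) (b ∷ y) e (s≤s x<y) with prefix-< x y (∷-injectiveʳ e) x<y
... | β , y≡ = β , cong₂ _∷_ (sym (∷-injectiveˡ e)) y≡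

drop-last : ∀ (x : Str) → 0 < length x → ∃[ c ] drop (length x ∸ 1) x ≡ [ c ]
drop-last (a ∷ []) _ = a , refl
drop-last (a ∷ b ∷ x) _ = drop-last (b ∷ x) (s≤s z≤n)

marker-last : ∀ {d} (a v : Str) {u} → All (d <_) v → a ++ d ∷ u ≡ v ++ [ d ] → u ≡ []
marker-last [] [] _ e = ∷-injectiveʳ e
marker-last [] (b ∷ v) (d<b ∷ _) e = ⊥-elim (<-irrefl (∷-injectiveˡ e) d<b)
marker-last (a ∷ []) [] _ ()
marker-last (a ∷ b ∷ as) [] _ ()
marker-last (a ∷ as) (b ∷ v) (_ ∷ d<v) e = marker-last as v d<v (∷-injectiveʳ e)

module TextFacts (T : Str) where
  open Text T

  suf-start : ∀ {k s} → k < n → suf k ≡ s → k + length s ≡ n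
  suf-start {k} k<n refl = trans (cong (k +_) (length-drop k T)) (m+[n∸m]≡n (<⇒≤ k<n))

  suf-injective : ∀ {k₁ k₂} → k₁ < n → k₂ < n → suf k₁ ≡ suf k₂ → k₁ ≡ k₂
  suf-injective {k₁} {k₂} k₁<n k₂<n e =
    +-cancelʳ-≡ (length (suf k₂)) k₁ k₂ (trans (suf-start k₁<n e) (sym (suf-start k₂<n refl)))

  rnk-mono : ∀ {k₁ k₂} → suf k₁ ≤lex suf k₂ → rnk k₁ ≤ rnk k₂
  rnk-mono {k₁} {k₂} s₁≤s₂ = count-mono (λ k → leqLex (suf k) (suf k₁)) (λ k → leqLex (suf k) (suf k₂))
    (λ k s≤s₁ → ≤lex-trans (suf k) (suf k₁) (suf k₂) s≤s₁ s₁≤s₂) (upTo n)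

  rnk-mono-< : ∀ {k₁ k₂} → k₂ < n → ¬ suf k₂ ≤lex suf k₁ → rnk k₁ < rnk k₂
  rnk-mono-< {k₁} {k₂} k₂<n s₂≰s₁ = count-mono-< (λ k → leqLex (suf k) (suf k₁)) (λ k → leqLex (suf k) (suf k₂))
    (λ k s≤s₁ → ≤lex-trans (suf k) (suf k₁) (suf k₂) s≤s₁ (≤lex-total (suf k₂) (suf k₁) s₂≰s₁))
    (upTo n) (∈-upTo⁺ k₂<n) (¬-not s₂≰s₁) (≤lex-refl (suf k₂))

  rnk-pos : ∀ {k} → k < n → 0 < rnk k
  rnk-pos {k} k<n = count-pos (λ k' → leqLex (suf k') (suf k)) (upTo n) (∈-upTo⁺ k<n) (≤lex-refl (suf k))

  rnk-≤ : ∀ k → rnk k ≤ n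
  rnk-≤ k = subst (rnk k ≤_) (length-upTo n) (count-≤-length (λ k' → leqLex (suf k') (suf k)) (upTo n))

  rnk-injective : ∀ {k₁ k₂} → k₁ < n → k₂ < n → rnk k₁ ≡ rnk k₂ → k₁ ≡ k₂
  rnk-injective {k₁} {k₂} k₁<n k₂<n r₁≡r₂ with suf k₁ ≤lex? suf k₂ | suf k₂ ≤lex? suf k₁
  ... | no s₁≰s₂ | _ = ⊥-elim (<-irrefl (sym r₁≡r₂) (rnk-mono-< {k₂} {k₁} k₁<n s₁≰s₂))
  ... | _ | no s₂≰s₁ = ⊥-elim (<-irrefl r₁≡r₂ (rnk-mono-< {k₁} {k₂} k₂<n s₂≰s₁))
  ... | yes s₁≤s₂ | yes s₂≤s₁ = suf-injective k₁<n k₂<n (≤lex-antisym (suf k₁) (suf k₂) s₁≤s₂ s₂≤s₁)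

  rnk-surjective : ∀ {i} → 0 < i → i ≤ n → ∃[ k ] k < n × rnk k ≡ i
  rnk-surjective {suc i} _ i<n with injective-below⇒surjective n (pred ∘ rnk) pred-rnk<n pred-rnk-injective i<n
    where
    suc-pred-rnk : ∀ {k} → k < n → suc (pred (rnk k)) ≡ rnk k
    suc-pred-rnk k<n = suc-pred _ {{>-nonZero (rnk-pos k<n)}}
    pred-rnk<n : ∀ k → k < n → pred (rnk k) < n
    pred-rnk<n k k<n = subst (_≤ n) (sym (suc-pred-rnk k<n)) (rnk-≤ k)
    pred-rnk-injective : ∀ {k₁ k₂} → k₁ < n → k₂ < n → pred (rnk k₁) ≡ pred (rnk k₂) → k₁ ≡ k₂
    pred-rnk-injective k₁<n k₂<n e = rnk-injective k₁<n k₂<n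
      (trans (sym (suc-pred-rnk k₁<n)) (trans (cong suc e) (suc-pred-rnk k₂<n)))
  ... | k , k<n , e = k , k<n , trans (sym (suc-pred _ {{>-nonZero (rnk-pos k<n)}})) (cong suc e)

  prevChar-single : ∀ {k} → k < n → ∃[ c ] prevChar k ≡ [ c ]
  prevChar-single {zero} 0<n = drop-last T 0<n
  prevChar-single {suc k} 1+k<n = head₀ (suf k) , cong (take 1) (drop-head₀ k T (<-trans (n<1+n k) 1+k<n))

  prevChar-inside-extension : ∀ {k k₂} (y y' z : Str) → k < n → k₂ < n →
    suf k ≡ y ++ z → suf k₂ ≡ y' ++ z → length y < length y' →
    prevChar k ≡ take 1 (drop (length y' ∸ suc (length y)) y')
  prevChar-inside-extension {k} {k₂} y y' z k<n k₂<n sk≡ sk₂≡ y<y' = begin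
    prevChar k                  ≡⟨ cong prevChar k≡ ⟩
    take 1 (drop (k₂ + e) T)    ≡⟨ cong (take 1) (sym (drop-drop k₂ e T)) ⟩
    take 1 (drop e (suf k₂))    ≡⟨ cong (take 1 ∘ drop e) sk₂≡ ⟩
    take 1 (drop e (y' ++ z))   ≡⟨ cong (take 1) (drop-++ˡ e y' z (<⇒≤ e<y')) ⟩
    take 1 (drop e y' ++ z)     ≡⟨ take-++ˡ 1 (drop e y') z (subst (1 ≤_) (sym (length-drop e y')) (m<n⇒0<n∸m e<y')) ⟩
    take 1 (drop e y')          ∎
    where
    open ≡-Reasoning
    open +-*-Solver
    e = length y' ∸ suc (length y)
    y'≡ : e + suc (length y) ≡ length y'
    y'≡ = m∸n+n≡m y<y'
    e<y' : e < length y'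
    e<y' = subst (e <_) y'≡ (m<m+n e (s≤s z≤n))
    starts : k + (length y + length z) ≡ k₂ + (length y' + length z)
    starts = trans (cong (k +_) (sym (length-++ y))) (trans (suf-start k<n sk≡)
               (sym (trans (cong (k₂ +_) (sym (length-++ y'))) (suf-start k₂<n sk₂≡))))
    k≡ : k ≡ suc (k₂ + e)
    k≡ = +-cancelʳ-≡ (length y + length z) k (suc (k₂ + e)) (trans starts (begin
      k₂ + (length y' + length z)                 ≡⟨ cong (λ l → k₂ + (l + length z)) (sym y'≡) ⟩
      k₂ + ((e + suc (length y)) + length z)      ≡⟨ solve 4 (λ a b c d → a :+ ((b :+ (con 1 :+ c)) :+ d) := (con 1 :+ (a :+ b)) :+ (c :+ d)) refl k₂ e (length y) (length z) ⟩
      suc (k₂ + e) + (length y + length z)        ∎))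

  EdgeAt-split : ∀ {S j x c} → EdgeAt S j x c → ∃[ r ] S ≡ x ++ c ∷ r × length x ≡ j
  EdgeAt-split {S} {j} (_ , take≡x , r , drop≡) = r ,
    trans (sym (take++drop≡id j S)) (cong₂ _++_ take≡x drop≡) ,
    trans (cong length (sym take≡x)) (length-take-≤ j S (<⇒≤ (drop≡∷⇒< j S drop≡)))

  divergence-branching : ∀ {k k' x c c' r r'} → suf k ≡ x ++ c ∷ r → suf k' ≡ x ++ c' ∷ r' →
    c ≢ c' → Branching x
  divergence-branching {k} {k'} {x} {c} {c'} {r} {r'} sk≡ sk'≡ c≢c' =
    c , c' , c≢c' , (k , r , trans sk≡ (sym (++-assoc x [ c ] r))) , (k' , r' , trans sk'≡ (sym (++-assoc x [ c' ] r')))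

  nonempty-node-branching : ∀ {y} → Node y → 0 < length y → Branching y
  nonempty-node-branching (inj₁ refl) ()
  nonempty-node-branching (inj₂ b) _ = b

  longest-of-distinct-prevChars : ∀ {k k'} (y z z' : Str) → k < n → k' < n → prevChar k ≢ prevChar k' →
    suf k ≡ y ++ z → suf k' ≡ y ++ z' → LongestInClass y
  longest-of-distinct-prevChars y z z' k<n k'<n pk≢pk' sk≡ sk'≡ y' y'∼y with length y' ≤? length y
  ... | yes y'≤y = y'≤y
  ... | no y'≰y with proj₂ (y'∼y z) (_ , k<n , sk≡) | proj₂ (y'∼y z') (_ , k'<n , sk'≡)
  ...   | _ , k₂<n , sk₂≡ | _ , k₃<n , sk₃≡ = ⊥-elim (pk≢pk' (trans
    (prevChar-inside-extension y y' z k<n k₂<n sk≡ sk₂≡ (≰⇒> y'≰y))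
    (sym (prevChar-inside-extension y y' z' k'<n k₃<n sk'≡ sk₃≡ (≰⇒> y'≰y)))))

  -- Node and EPm are not decidable constructively; under the double negation,
  -- excluded middle decides them and so locates the first non-(−)-primary edge.
  canonical-criterion : ∀ S h →
    (∀ j x c → j < h → EdgeAt S j x c → ¬ ¬ EPm x c) →
    (∀ j x c → h < j → EdgeAt S j x c → EPp x c) →
    ¬ ¬ Canonical S
  canonical-criterion S h primary-before primary-after ¬canonical =
    ¬¬-decidable-below NodeAt (length S) λ node? →
    ¬¬-decidable-below PrimaryAt (length S) λ primary? →
    ¬canonical (canonical node? primary?)
    where
    NodeAt PrimaryAt : ℕ → Set
    NodeAt j = Node (take j S)
    PrimaryAt j = EPm (take j S) (head₀ (drop j S))

    edge-at : ∀ j → j < length S → NodeAt j → EdgeAt S j (take j S) (head₀ (drop j S))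
    edge-at j j<S node = node , refl , drop (suc j) S , drop-head₀ j S j<S

    canonical : (∀ j → j < length S → Dec (NodeAt j)) → (∀ j → j < length S → Dec (PrimaryAt j)) →
      Canonical S
    canonical node? primary? with least-or-none (λ j → NodeAt j × ¬ PrimaryAt j) (length S)
                                    (λ j j<S → node? j j<S ×-dec ¬? (primary? j j<S))
    ... | inj₂ none = inj₁ primary
      where
      primary : ∀ j x c → EdgeAt S j x c → EPm x c
      primary j x c (node , take≡x , r , drop≡) with primary? j (drop≡∷⇒< j S drop≡)
      ... | yes p = subst₂ EPm take≡x (cong head₀ drop≡) p
      ... | no ¬p = ⊥-elim (none j (drop≡∷⇒< j S drop≡) (subst Node (sym take≡x) node , ¬p))
    ... | inj₁ (j₀ , j₀<S , (node₀ , ¬primary₀) , least) =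
      inj₂ (j₀ , _ , _ , edge-at j₀ j₀<S node₀ , ¬primary₀ , before , after)
      where
      before : ∀ j x c → j < j₀ → EdgeAt S j x c → EPm x c
      before j x c j<j₀ (node , take≡x , r , drop≡) with primary? j (<-trans j<j₀ j₀<S)
      ... | yes p = subst₂ EPm take≡x (cong head₀ drop≡) p
      ... | no ¬p = ⊥-elim (least j j<j₀ (subst Node (sym take≡x) node , ¬p))
      after : ∀ j x c → j₀ < j → EdgeAt S j x c → EPp x c
      after j x c j₀<j edge with h ≤? j₀
      ... | yes h≤j₀ = primary-after j x c (≤-<-trans h≤j₀ j₀<j) edge
      ... | no h≰j₀ = ⊥-elim (primary-before j₀ _ _ (≰⇒> h≰j₀) (edge-at j₀ j₀<S node₀) ¬primary₀)

  EPp-beyond-minimal : ∀ {k x c r} → k < n → suf k ≡ x ++ c ∷ r →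
    (∀ z → Suf (x ++ c ∷ z) → suf k ≤lex (x ++ c ∷ z)) →
    ∀ j xj cj → length x < j → EdgeAt (suf k) j xj cj → EPp xj cj
  EPp-beyond-minimal {k} {x} {c} k<n sk≡ minimal j xj cj x<j edge with EdgeAt-split edge
  ... | rj , sk≡j , xj-length with prefix-< x xj (trans (sym sk≡) sk≡j) (subst (length x <_) (sym xj-length) x<j)
  ...   | β , xj≡ = rj , (k , k<n , sk≡j) , smallest
    where
    extends : ∀ z' → xj ++ z' ≡ x ++ c ∷ (β ++ z')
    extends z' = trans (cong (_++ z') xj≡) (++-assoc x (c ∷ β) z')
    smallest : ∀ z' → Suf (xj ++ z') → (cj ∷ rj) ≤lex z'
    smallest z' suffix = trans (sym (leqLex-++ xj (cj ∷ rj) z'))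
      (subst₂ _≤lex_ sk≡j (sym (extends z')) (minimal (β ++ z') (subst Suf (extends z') suffix)))

  EPm-of-least-node : ∀ {k k' x r r' j xj cj} → k < n → k' < n → prevChar k ≢ prevChar k' →
    suf k ≡ x ++ r → suf k' ≡ x ++ r' → EdgeAt (suf k) j xj cj →
    LeastBelow (λ m → j < m × Node (take m x)) (suc (length x)) → EPm xj cj
  EPm-of-least-node {k} {k'} {x} {r} {r'} {j} {xj} k<n k'<n pk≢pk' sk≡ sk'≡ edge (m , m<1+x , (j<m , node-y) , least) =
    y , xj , inj₁ branching , longest , (proj₁ edge , prefix-< xj y (trans (sym sk≡j) sk≡y) xj<y , only-shorter) , λ _ → id , id
    where
    y = take m x
    y-length : length y ≡ m
    y-length = length-take-≤ m x (s≤s⁻¹ m<1+x)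
    x≡ : x ≡ y ++ drop m x
    x≡ = sym (take++drop≡id m x)
    sk≡y : suf k ≡ y ++ (drop m x ++ r)
    sk≡y = trans sk≡ (trans (cong (_++ r) x≡) (++-assoc y (drop m x) r))
    sk'≡y : suf k' ≡ y ++ (drop m x ++ r')
    sk'≡y = trans sk'≡ (trans (cong (_++ r') x≡) (++-assoc y (drop m x) r'))
    sk≡j = proj₁ (proj₂ (EdgeAt-split edge))
    xj-length = proj₂ (proj₂ (EdgeAt-split edge))
    xj<y : length xj < length y
    xj<y = subst₂ _<_ (sym xj-length) (sym y-length) j<m
    branching : Branching y
    branching = nonempty-node-branching node-y (subst (0 <_) (sym y-length) (≤-trans (s≤s z≤n) j<m))
    longest : LongestInClass y
    longest = longest-of-distinct-prevChars y _ _ k<n k'<n pk≢pk' sk≡y sk'≡y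
    only-shorter : ∀ q d γ → y ≡ q ++ d ∷ γ → Node q → length q ≤ length xj
    only-shorter q d γ y≡ node-q with length q ≤? length xj
    ... | yes q≤xj = q≤xj
    ... | no q≰xj = ⊥-elim (least (length q) q<m (subst (_< length q) xj-length (≰⇒> q≰xj) , subst Node (sym x-prefix) node-q))
      where
      q<m : length q < m
      q<m = subst (length q <_) (trans (sym (length-++ q)) (trans (cong length (sym y≡)) y-length)) (m<m+n (length q) (s≤s z≤n))
      x-prefix : take (length q) x ≡ q
      x-prefix = trans (cong (take (length q)) (trans x≡ (trans (cong (_++ drop m x) y≡) (++-assoc q (d ∷ γ) (drop m x)))))
                       (take-length-++ q (d ∷ γ ++ drop m x))

  EPm-before-divergence : ∀ {k k' x c c' r r'} → k < n → k' < n → prevChar k ≢ prevChar k' →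
    suf k ≡ x ++ c ∷ r → suf k' ≡ x ++ c' ∷ r' → c ≢ c' →
    ∀ j xj cj → j < length x → EdgeAt (suf k) j xj cj → ¬ ¬ EPm xj cj
  EPm-before-divergence {k} {k'} {x} k<n k'<n pk≢pk' sk≡ sk'≡ c≢c' j xj cj j<x edge ¬EPm =
    ¬¬-decidable-below (λ m → Node (take m x)) (suc (length x)) λ node? →
    [ ¬EPm ∘ EPm-of-least-node k<n k'<n pk≢pk' sk≡ sk'≡ edge , (λ none → none (length x) ≤-refl x-node-after) ]′
      (least-or-none (λ m → j < m × Node (take m x)) (suc (length x)) (λ m m≤x → (j <? m) ×-dec node? m m≤x))
    where
    x-node-after : j < length x × Node (take (length x) x)
    x-node-after = j<x , subst Node (sym (take-all (length x) x ≤-refl)) (inj₂ (divergence-branching {k} {k'} sk≡ sk'≡ c≢c'))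

  rnk-one-canonical : ∀ {k} → k < n → rnk k ≡ 1 → ¬ ¬ Canonical (suf k)
  rnk-one-canonical {k} k<n rk≡1 = canonical-criterion (suf k) 0 (λ _ _ _ ())
    (EPp-beyond-minimal {x = []} k<n (drop-head₀ k T k<n) minimal)
    where
    minimal : ∀ z → Suf (head₀ (suf k) ∷ z) → suf k ≤lex (head₀ (suf k) ∷ z)
    minimal z (k'' , k''<n , sk''≡) with suf k ≤lex? suf k''
    ... | yes sk≤sk'' = subst (suf k ≤lex_) sk''≡ sk≤sk''
    ... | no sk≰sk'' = ⊥-elim (<⇒≱ (subst (rnk k'' <_) rk≡1 (rnk-mono-< {k''} {k} k<n sk≰sk'')) (rnk-pos k''<n))

module EndMarked (w : Str) (d : ℕ) (d<w : All (d <_) w) where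
  open Text (w ++ [ d ])
  open TextFacts (w ++ [ d ])

  suf-marked : ∀ {k} → k < n → suf k ≡ drop k w ++ [ d ]
  suf-marked {k} k<n = drop-++ˡ k w [ d ] (s≤s⁻¹ (subst (k <_) (trans (length-++ w) (+-comm (length w) 1)) k<n))

  suffix-prefix-free : ∀ {k₁ k₂ u} → k₁ < n → k₂ < n → suf k₁ ++ u ≡ suf k₂ → u ≡ []
  suffix-prefix-free {k₁} {k₂} {u} k₁<n k₂<n e = marker-last (drop k₁ w) (drop k₂ w) (drop⁺ k₂ d<w)
    (trans (sym (++-assoc (drop k₁ w) [ d ] u)) (trans (cong (_++ u) (sym (suf-marked k₁<n))) (trans e (suf-marked k₂<n))))

  adjacent-canonical : ∀ {k k'} → k < n → k' < n → rnk k ≡ suc (rnk k') → prevChar k ≢ prevChar k' →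
    ¬ ¬ Canonical (suf k)
  adjacent-canonical {k} {k'} k<n k'<n rk≡ pk≢pk' =
    from-split (≤lex-split (suf k') (suf k) (≤lex-total (suf k) (suf k') sk≰sk'))
    where
    sk≰sk' : ¬ suf k ≤lex suf k'
    sk≰sk' sk≤sk' = <-irrefl rk≡ (s≤s (rnk-mono {k} {k'} sk≤sk'))

    from-split : (∃[ u ] suf k' ++ u ≡ suf k) ⊎ Divergence (suf k') (suf k) → ¬ ¬ Canonical (suf k)
    from-split (inj₁ (u , sk'++u≡sk)) = ⊥-elim (sk≰sk' (subst (suf k ≤lex_) sk≡sk' (≤lex-refl (suf k))))
      where
      sk≡sk' : suf k ≡ suf k'
      sk≡sk' = trans (sym sk'++u≡sk) (trans (cong (suf k' ++_) (suffix-prefix-free k'<n k<n sk'++u≡sk)) (++-identityʳ (suf k')))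
    from-split (inj₂ (divergence x c'<c sk'≡ sk≡)) = canonical-criterion (suf k) (length x)
      (EPm-before-divergence k<n k'<n pk≢pk' sk≡ sk'≡ (λ c≡c' → <-irrefl (sym c≡c') c'<c))
      (EPp-beyond-minimal k<n sk≡ minimal)
      where
      minimal : ∀ z → Suf (x ++ _ ∷ z) → suf k ≤lex (x ++ _ ∷ z)
      minimal z (k'' , k''<n , sk''≡) with suf k ≤lex? suf k''
      ... | yes sk≤sk'' = subst (suf k ≤lex_) sk''≡ sk≤sk''
      ... | no sk≰sk'' = ⊥-elim (<-irrefl (sym rk≡) (≤-<-trans (rnk-mono-< {k'} {k''} k''<n sk''≰sk') (rnk-mono-< {k''} {k} k<n sk≰sk'')))
        where
        sk''≰sk' : ¬ suf k'' ≤lex suf k'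
        sk''≰sk' = subst₂ (λ s t → ¬ s ≤lex t) (sym sk''≡) (sym sk'≡)
          λ le → leqLex-head> z _ c'<c (trans (sym (leqLex-++ x _ _)) le)

lemma5 : (T : Str) → IsText T → (i : ℕ) → 1 ≤ i → i ≤ Text.n T →
    ¬ Text.InQI T i →
    (1 < i) × (Σ[ c ∈ ℕ ] Text.BWT T i c × Text.BWT T (i Data.Nat.∸ 1) c)
lemma5 .(w ++ [ d ]) (w , d , refl , d<w) = BWT-repeats
  where
  open Text (w ++ [ d ])
  open TextFacts (w ++ [ d ])
  open EndMarked w d d<w

  BWT-repeats : ∀ i → 1 ≤ i → i ≤ n → ¬ InQI i → (1 < i) × (Σ[ c ∈ ℕ ] BWT i c × BWT (i ∸ 1) c)
  BWT-repeats i 1≤i i≤n i∉QI with rnk-surjective 1≤i i≤n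
  ... | k , k<n , rk≡i with 1 <? i
  ...   | no i≯1 = ⊥-elim (rnk-one-canonical k<n (trans rk≡i (≤-antisym (≮⇒≥ i≯1) 1≤i)) (λ can → i∉QI (k , k<n , can , rk≡i)))
  ...   | yes 1<i with rnk-surjective (m<n⇒0<n∸m 1<i) (≤-trans (m∸n≤m i 1) i≤n) | prevChar-single k<n
  ...     | k' , k'<n , rk'≡ | c , pk≡c with ≡-dec _≟_ (prevChar k') [ c ]
  ...       | yes pk'≡c = 1<i , c , (k , k<n , rk≡i , pk≡c) , (k' , k'<n , rk'≡ , pk'≡c)
  ...       | no pk'≢c = ⊥-elim (adjacent-canonical k<n k'<n (trans rk≡i (sym (trans (cong suc rk'≡) (m+[n∸m]≡n 1≤i))))
                                   (λ pk≡pk' → pk'≢c (trans (sym pk≡pk') pk≡c)) (λ can → i∉QI (k , k<n , can , rk≡i)))
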